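{- Let $m\ge1$. For every $\pi\in L^+_{4m-1,4}$, $h^-_m(\pi)=h^+_{(4m-1)/4}(\pi)$.
   Context: For positive integers $r,s$, an $r\times s$ Dyck path is a lattice path from $(0,0)$ to $(r,s)$ with unit north and east steps that never goes below the line segment from $(0,0)$ to $(r,s)$; $L^+_{r,s}$ is the set of these. For $\pi\in L^+_{r,s}$, the unit squares in the triangle with vertices $(0,0),(0,s),(r,s)$ lying above $\pi$ form a partition diagram $D(\pi)$ (justified at the corner $(0,s)$). For $c\in D(\pi)$, $a(c)$ is the number of cells of $D(\pi)$ to its right in its row and $l(c)$ the number of cells of $D(\pi)$ below it in its column. For real $x>0$, $h^+_x(\pi)=\#\{c\in D(\pi):\frac{a(c)}{l(c)+1}\le x<\frac{a(c)+1}{l(c)}\}$ and $h^-_x(\pi)=\#\{c\in D(\pi):\frac{a(c)}{l(c)+1}<x\le\frac{a(c)+1}{l(c)}\}$, with the convention $\frac{a(c)+1}{0}=+\infty$. -}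

module Defs where

open import Data.Nat using (ℕ; zero; suc; _+_; _*_; _∸_; _≤_; _<_; _<?_)
open import Data.List using (List; []; _∷_; length; filter; map; concatMap; upTo; allFin)
open import Data.Product using (_×_; _,_)
open import Data.Unit using (⊤)
open import Data.Integer using (+_)
open import Data.Rational using (ℚ; _/_) renaming (_≤_ to _≤ℚ_; _<_ to _<ℚ_)
import Data.Rational.Properties as ℚP
open import Relation.Nullary using (Dec; yes; no)
open import Relation.Nullary.Decidable using (_×-dec_)
open import Relation.Binary.PropositionalEquality using (_≡_)

data Step : Set where
  N E : Step

#E : List Step → ℕ
#E [] = 0
#E (E ∷ p) = suc (#E p)
#E (N ∷ p) = #E p

#N : List Step → ℕ
#N [] = 0
#N (N ∷ p) = suc (#N p)
#N (E ∷ p) = #N p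

-- NotBelow r s x y p : starting at the lattice point (x , y), every vertex
-- visited by p (including (x , y)) lies weakly above the line through
-- (0,0) and (r,s), i.e.  x * s ≤ y * r.  Since steps are unit segments and
-- the line is straight, this is the same as the whole path never going below.
NotBelow : ℕ → ℕ → ℕ → ℕ → List Step → Set
NotBelow r s x y [] = x * s ≤ y * r
NotBelow r s x y (N ∷ p) = (x * s ≤ y * r) × NotBelow r s x (suc y) p
NotBelow r s x y (E ∷ p) = (x * s ≤ y * r) × NotBelow r s (suc x) y p

IsDyck : ℕ → ℕ → List Step → Set
IsDyck r s π = (#E π ≡ r) × (#N π ≡ s) × NotBelow r s 0 0 π

-- Row lengths of D(π), listed from the bottom row (y ∈ [0,1]) to the top row
-- (y ∈ [s-1,s]): the row between heights j and j+1 consists of the cells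
-- [i,i+1]×[j,j+1] with i+1 ≤ (number of E steps before the (j+1)-st N step).
rowsFrom : ℕ → List Step → List ℕ
rowsFrom k [] = []
rowsFrom k (E ∷ p) = rowsFrom (suc k) p
rowsFrom k (N ∷ p) = k ∷ rowsFrom k p

rows : List Step → List ℕ
rows π = rowsFrom 0 π

-- A cell of D(π) together with its arm and leg:
-- cell (i , j) = unit square [i,i+1]×[j,j+1];
-- arm  = cells of D(π) to its right in its row,
-- leg  = cells of D(π) below it in its column.
record Cell : Set where
  constructor cell
  field
    arm : ℕ
    leg : ℕ

-- number of rows among the given ones (all below the current one) that
-- contain column i, i.e. have length > i
below : ℕ → List ℕ → ℕ
below i [] = 0
below i (x ∷ xs) with i <? x
... | yes _ = suc (below i xs)
... | no _ = below i xs

cellsFrom : List ℕ → List ℕ → List Cell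
cellsFrom lower [] = []
cellsFrom lower (x ∷ xs) =
  Data.List._++_ (map (λ i → cell (x ∸ suc i) (below i lower)) (upTo x))
                 (cellsFrom (x ∷ lower) xs)

D : List Step → List Cell
D π = cellsFrom [] (rows π)


lo : Cell → ℚ
lo (cell a l) = + a / suc l

-- upper bound (a(c)+1)/l(c) < x  resp.  x ≤ (a(c)+1)/l(c),
-- with the convention (a(c)+1)/0 = +∞
_<hi_ : ℚ → Cell → Set
x <hi cell a zero = ⊤
x <hi cell a (suc l) = x <ℚ (+ suc a / suc l)

_≤hi_ : ℚ → Cell → Set
x ≤hi cell a zero = ⊤
x ≤hi cell a (suc l) = x ≤ℚ (+ suc a / suc l)

<hi? : (x : ℚ) (c : Cell) → Dec (x <hi c)
<hi? x (cell a zero) = yes _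
<hi? x (cell a (suc l)) = x ℚP.<? (+ suc a / suc l)

≤hi? : (x : ℚ) (c : Cell) → Dec (x ≤hi c)
≤hi? x (cell a zero) = yes _
≤hi? x (cell a (suc l)) = x ℚP.≤? (+ suc a / suc l)

h⁺ : ℚ → List Step → ℕ
h⁺ x π = length (filter (λ c → (lo c ℚP.≤? x) ×-dec <hi? x c) (D π))

h⁻ : ℚ → List Step → ℕ
h⁻ x π = length (filter (λ c → (lo c ℚP.<? x) ×-dec ≤hi? x c) (D π))

-- A cell with arm a and leg l is counted by h⁻_m iff a < m(l+1) and m l ≤ a+1, and
-- the same holds for h⁺_{(sm-1)/s} as soon as l < s: after clearing denominators,
-- (sm-1)(l+1) and (sm-1)l fall short of the multiples s·m(l+1) and s·m l by at most
-- s, too little to change a comparison with s a or s(a+1). A path with s north steps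
-- has s rows, so every leg is below s.
module Submission where

open import Data.Nat using (ℕ; zero; suc; _+_; _*_; _∸_; _≤_; _<_; _<?_; s≤s; s≤s⁻¹; z≤n)
open import Data.Nat.Properties
open import Data.Integer using (+_)
import Data.Integer as ℤ
import Data.Integer.Properties as ℤP
open import Data.Rational using (ℚ; _/_; toℚᵘ) renaming (_≤_ to _≤ℚ_; _<_ to _<ℚ_)
open import Data.Rational.Properties
  using (toℚᵘ-fromℚᵘ; toℚᵘ-mono-≤; toℚᵘ-cancel-≤; toℚᵘ-mono-<; toℚᵘ-cancel-<)
open import Data.Rational.Unnormalised using (mkℚᵘ; _≃_; *≤*; *<*) renaming (_≤_ to _≤ᵘ_; _<_ to _<ᵘ_)
import Data.Rational.Unnormalised.Properties as ℚᵘP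
open import Data.List using (List; []; _∷_; length; filter)
open import Data.List.Properties using (filter-accept; filter-reject)
open import Data.List.Relation.Unary.All as All using (All; []; _∷_)
import Data.List.Relation.Unary.All.Properties as AllP
open import Data.Product using (_×_; _,_)
open import Data.Product.Function.NonDependent.Propositional using (_×-⇔_)
open import Function using (_∘_)
open import Function.Bundles using (_⇔_; mk⇔; Equivalence)
open import Function.Construct.Composition using (_⇔-∘_)
open import Function.Construct.Identity using (⇔-id)
open import Function.Construct.Symmetry using (⇔-sym)
open import Relation.Nullary using (yes; no)
open import Relation.Unary using (Pred; Decidable)
open import Relation.Binary.PropositionalEquality
open import Defs

open Equivalence using (to; from)

toℚᵘ-/ : ∀ i b → toℚᵘ (i / suc b) ≃ mkℚᵘ i b
toℚᵘ-/ i b = toℚᵘ-fromℚᵘ (mkℚᵘ i b)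

+*+≡+* : ∀ a b → + a ℤ.* + b ≡ + (a * b)
+*+≡+* a b = ℤP.+◃n≡+n (a * b)

mkℚᵘ≤mkℚᵘ⇔*≤* : ∀ a b c d → (mkℚᵘ (+ a) b ≤ᵘ mkℚᵘ (+ c) d) ⇔ (a * suc d ≤ c * suc b)
mkℚᵘ≤mkℚᵘ⇔*≤* a b c d = mk⇔
  (ℤP.drop‿+≤+ ∘ subst₂ ℤ._≤_ (+*+≡+* a (suc d)) (+*+≡+* c (suc b)) ∘ ℚᵘP.drop-*≤*)
  (*≤* ∘ subst₂ ℤ._≤_ (sym (+*+≡+* a (suc d))) (sym (+*+≡+* c (suc b))) ∘ ℤ.+≤+)

mkℚᵘ<mkℚᵘ⇔*<* : ∀ a b c d → (mkℚᵘ (+ a) b <ᵘ mkℚᵘ (+ c) d) ⇔ (a * suc d < c * suc b)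
mkℚᵘ<mkℚᵘ⇔*<* a b c d = mk⇔
  (ℤP.drop‿+<+ ∘ subst₂ ℤ._<_ (+*+≡+* a (suc d)) (+*+≡+* c (suc b)) ∘ ℚᵘP.drop-*<*)
  (*<* ∘ subst₂ ℤ._<_ (sym (+*+≡+* a (suc d))) (sym (+*+≡+* c (suc b))) ∘ ℤ.+<+)

/≤/⇔*≤* : ∀ a b c d → (+ a / suc b ≤ℚ + c / suc d) ⇔ (a * suc d ≤ c * suc b)
/≤/⇔*≤* a b c d = mkℚᵘ≤mkℚᵘ⇔*≤* a b c d ⇔-∘ mk⇔
  (λ p → ℚᵘP.≤-respʳ-≃ (toℚᵘ-/ (+ c) d) (ℚᵘP.≤-respˡ-≃ (toℚᵘ-/ (+ a) b) (toℚᵘ-mono-≤ p)))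
  (λ q → toℚᵘ-cancel-≤ (ℚᵘP.≤-respʳ-≃ (ℚᵘP.≃-sym (toℚᵘ-/ (+ c) d)) (ℚᵘP.≤-respˡ-≃ (ℚᵘP.≃-sym (toℚᵘ-/ (+ a) b)) q)))

/</⇔*<* : ∀ a b c d → (+ a / suc b <ℚ + c / suc d) ⇔ (a * suc d < c * suc b)
/</⇔*<* a b c d = mkℚᵘ<mkℚᵘ⇔*<* a b c d ⇔-∘ mk⇔
  (λ p → ℚᵘP.<-respʳ-≃ (toℚᵘ-/ (+ c) d) (ℚᵘP.<-respˡ-≃ (toℚᵘ-/ (+ a) b) (toℚᵘ-mono-< p)))
  (λ q → toℚᵘ-cancel-< (ℚᵘP.<-respʳ-≃ (ℚᵘP.≃-sym (toℚᵘ-/ (+ c) d)) (ℚᵘP.<-respˡ-≃ (ℚᵘP.≃-sym (toℚᵘ-/ (+ a) b)) q)))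

s*a≤e+s*n⇔a≤n : ∀ {s e} a n → e < s → (s * a ≤ e + s * n) ⇔ (a ≤ n)
s*a≤e+s*n⇔a≤n {s} {e} a n e<s = mk⇔
  (λ sa≤ → ≮⇒≥ (λ n<a → <⇒≱ (e+s*n<s*a n<a) sa≤))
  (λ a≤n → ≤-trans (*-monoʳ-≤ s a≤n) (m≤n+m (s * n) e))
  where
  e+s*n<s*a : n < a → e + s * n < s * a
  e+s*n<s*a n<a = begin-strict
    e + s * n   <⟨ +-monoˡ-< (s * n) e<s ⟩
    s + s * n   ≡⟨ *-suc s n ⟨
    s * suc n   ≤⟨ *-monoʳ-≤ s n<a ⟩
    s * a       ∎
    where open ≤-Reasoning

e+s*n<s*b⇔n<b : ∀ {s e} n b → e < s → (e + s * n < s * b) ⇔ (n < b)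
e+s*n<s*b⇔n<b n b e<s = mk⇔
  (λ lt → ≰⇒> (λ b≤n → <⇒≱ lt (from (s*a≤e+s*n⇔a≤n b n e<s) b≤n)))
  (λ n<b → ≰⇒> (λ sb≤ → <⇒≱ n<b (to (s*a≤e+s*n⇔a≤n b n e<s) sb≤)))

-- (s m - 1) j = (s - j) + s (m j - 1), with m j - 1 written without subtraction.
*∸1-*-decomposition : ∀ s k l → suc l ≤ s →
  (s * suc k ∸ 1) * suc l ≡ (s ∸ suc l) + s * (l + k * suc l)
*∸1-*-decomposition s k l j≤s = begin
  (s * suc k ∸ 1) * suc l        ≡⟨ *-distribʳ-∸ (suc l) (s * suc k) 1 ⟩
  s * suc k * suc l ∸ 1 * suc l  ≡⟨ cong₂ _∸_ (*-assoc s (suc k) (suc l)) (*-identityˡ (suc l)) ⟩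
  s * suc n ∸ suc l              ≡⟨ cong (_∸ suc l) (*-suc s n) ⟩
  (s + s * n) ∸ suc l            ≡⟨ +-∸-comm (s * n) j≤s ⟩
  (s ∸ suc l) + s * n            ∎
  where
  open ≡-Reasoning
  n = l + k * suc l

filter-cong : ∀ {a p q} {A : Set a} {P : Pred A p} {Q : Pred A q}
  (P? : Decidable P) (Q? : Decidable Q) {xs : List A} →
  All (λ x → P x ⇔ Q x) xs → filter P? xs ≡ filter Q? xs
filter-cong P? Q? [] = refl
filter-cong P? Q? {x ∷ xs} (P⇔Q ∷ rest) with P? x
... | yes px = trans (cong (x ∷_) (filter-cong P? Q? rest)) (sym (filter-accept Q? (to P⇔Q px)))
... | no ¬px = trans (filter-cong P? Q? rest) (sym (filter-reject Q? (¬px ∘ from P⇔Q)))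

length-rowsFrom : ∀ k π → length (rowsFrom k π) ≡ #N π
length-rowsFrom k [] = refl
length-rowsFrom k (E ∷ π) = length-rowsFrom (suc k) π
length-rowsFrom k (N ∷ π) = cong suc (length-rowsFrom k π)

below≤length : ∀ i rs → below i rs ≤ length rs
below≤length i [] = z≤n
below≤length i (r ∷ rs) with i <? r
... | yes _ = s≤s (below≤length i rs)
... | no _ = m≤n⇒m≤1+n (below≤length i rs)

leg<#rows : ∀ lower rs → All (λ c → Cell.leg c < length lower + length rs) (cellsFrom lower rs)
leg<#rows lower [] = []
leg<#rows lower (r ∷ rs) rewrite +-suc (length lower) (length rs) =
  AllP.++⁺ (AllP.map⁺ (All.tabulate (λ {i} _ → s≤s (≤-trans (below≤length i lower) (m≤m+n _ _)))))
           (leg<#rows (r ∷ lower) rs)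

leg<#N : ∀ π → All (λ c → Cell.leg c < #N π) (D π)
leg<#N π = All.map (λ {c} → subst (Cell.leg c <_) (length-rowsFrom 0 π)) (leg<#rows [] (rows π))

module _ (k t : ℕ) where

  m s : ℕ
  m = suc k
  s = suc t

  x y : ℚ
  x = + m / 1
  y = + (s * m ∸ 1) / s

  lo<x⇔ : ∀ a l → (lo (cell a l) <ℚ x) ⇔ (a < m * suc l)
  lo<x⇔ a l = subst (λ z → (lo (cell a l) <ℚ x) ⇔ (z < m * suc l)) (*-identityʳ a) (/</⇔*<* a l m 0)

  x≤hi⇔ : ∀ a l → (x ≤hi cell a (suc l)) ⇔ (m * suc l ≤ suc a)
  x≤hi⇔ a l = subst (λ z → (x ≤hi cell a (suc l)) ⇔ (m * suc l ≤ z)) (*-identityʳ (suc a))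
    (/≤/⇔*≤* m 0 (suc a) l)

  lo≤y⇔ : ∀ a l → suc l ≤ s → (lo (cell a l) ≤ℚ y) ⇔ (a < m * suc l)
  lo≤y⇔ a l j≤s = mk⇔ s≤s s≤s⁻¹ ⇔-∘ (s*a≤e+s*n⇔a≤n a _ (s≤s (m∸n≤m t l)) ⇔-∘ clear)
    where
    clear : (lo (cell a l) ≤ℚ y) ⇔ (s * a ≤ (s ∸ suc l) + s * (l + k * suc l))
    clear = subst₂ (λ u v → (lo (cell a l) ≤ℚ y) ⇔ (u ≤ v))
      (*-comm a s) (*∸1-*-decomposition s k l j≤s)
      (/≤/⇔*≤* a l (s * m ∸ 1) t)

  y<hi⇔ : ∀ a l → suc l ≤ s → (y <hi cell a (suc l)) ⇔ (m * suc l ≤ suc a)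
  y<hi⇔ a l j≤s = e+s*n<s*b⇔n<b _ (suc a) (s≤s (m∸n≤m t l)) ⇔-∘ clear
    where
    clear : (y <hi cell a (suc l)) ⇔ ((s ∸ suc l) + s * (l + k * suc l) < s * suc a)
    clear = subst₂ (λ u v → (y <hi cell a (suc l)) ⇔ (u < v))
      (*∸1-*-decomposition s k l j≤s) (*-comm (suc a) s)
      (/</⇔*<* (s * m ∸ 1) t (suc a) l)

  window⁻⇔window⁺ : ∀ c → Cell.leg c < s →
    ((lo c <ℚ x) × (x ≤hi c)) ⇔ ((lo c ≤ℚ y) × (y <hi c))
  window⁻⇔window⁺ (cell a zero) l<s =
    (⇔-sym (lo≤y⇔ a 0 l<s) ⇔-∘ lo<x⇔ a 0) ×-⇔ ⇔-id _
  window⁻⇔window⁺ (cell a (suc l)) l<s =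
    (⇔-sym (lo≤y⇔ a (suc l) l<s) ⇔-∘ lo<x⇔ a (suc l))
      ×-⇔ (⇔-sym (y<hi⇔ a l (<⇒≤ l<s)) ⇔-∘ x≤hi⇔ a l)

  h⁻≡h⁺ : ∀ π → #N π ≡ s → h⁻ x π ≡ h⁺ y π
  h⁻≡h⁺ π #N≡s = cong length (filter-cong _ _
    (All.map (λ {c} leg< → window⁻⇔window⁺ c (subst (Cell.leg c <_) #N≡s leg<)) (leg<#N π)))

lemma6p4 : (m : ℕ) → 1 ≤ m → (π : List Step) → IsDyck (4 * m ∸ 1) 4 π →
    h⁻ (+ m / 1) π ≡ h⁺ (+ (4 * m ∸ 1) / 4) π
lemma6p4 (suc k) _ π (_ , #N≡4 , _) = h⁻≡h⁺ k 3 π #N≡4
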